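{- Let $2k+1$ be a prime and let $G$ and $H$ be finite simple graphs. Suppose $G$ admits a $(2k+1)$-neighborhood balanced coloring $g$ with $\sigma_G(R_1)=\sigma_G(R_2)=\dots=\sigma_G(R_{2k+1})$ and $H$ admits a $(2k+1)$-neighborhood balanced coloring $h$ with $\sigma_H(R_1)=\sigma_H(R_2)=\dots=\sigma_H(R_{2k+1})$. Then the join $G+H$ admits a $(2k+1)$-neighborhood balanced coloring.
   Context: For a prime $2k+1$ (with $k\ge 1$), a $(2k+1)$-neighborhood balanced coloring of a finite simple graph is an assignment to each vertex of one of $2k+1$ colors $R_1,\dots,R_{2k+1}$ such that every vertex has an equal number of neighbors of each color. $\sigma_G(R_i)$ denotes the number of vertices of $G$ having color $R_i$ (under $g$), and similarly $\sigma_H(R_i)$ under $h$. The join $G+H$ of vertex-disjoint graphs has vertex set $V(G)\cup V(H)$ and edge set $E(G)\cup E(H)\cup\{xy : x\in V(G),\ y\in V(H)\}$. -}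

module Defs where

open import Data.Nat using (ℕ; suc; _+_; _*_)
open import Data.Bool using (Bool; true; false; _∧_)
open import Data.Fin using (Fin; splitAt)
open import Data.Fin.Properties using (_≟_)
open import Data.Sum using (inj₁; inj₂)
open import Data.List using (List; filter; length)
open import Data.List.Base using (allFin)
open import Data.Product using (Σ; _×_)
open import Relation.Binary.PropositionalEquality using (_≡_)
open import Relation.Nullary.Decidable using (does)
open import Relation.Unary using (Decidable)

record Graph (n : ℕ) : Set where
  field
    adj   : Fin n → Fin n → Bool
    sym   : ∀ u v → adj u v ≡ adj v u
    irrefl : ∀ v → adj v v ≡ false
open Graph public

countB : ∀ {n} → (Fin n → Bool) → ℕ
countB {n} p = length (filter (λ w → Data.Bool._≟_ (p w) true) (allFin n))

nbrsOfColour : ∀ {n r} → Graph n → (Fin n → Fin r) → Fin n → Fin r → ℕ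
nbrsOfColour G f v c = countB (λ w → adj G v w ∧ does (f w ≟ c))

σ : ∀ {n r} → (Fin n → Fin r) → Fin r → ℕ
σ f c = countB (λ w → does (f w ≟ c))

IsNBColoring : ∀ {n} (r : ℕ) → Graph n → (Fin n → Fin r) → Set
IsNBColoring r G f = ∀ v (c c′ : Fin r) → nbrsOfColour G f v c ≡ nbrsOfColour G f v c′

joinAdj : ∀ {n m} → Graph n → Graph m → Fin (n + m) → Fin (n + m) → Bool
joinAdj {n} G H u v with splitAt n u | splitAt n v
... | inj₁ x | inj₁ y = adj G x y
... | inj₂ x | inj₂ y = adj H x y
... | inj₁ _ | inj₂ _ = true
... | inj₂ _ | inj₁ _ = true

joinSym : ∀ {n m} (G : Graph n) (H : Graph m) u v → joinAdj G H u v ≡ joinAdj G H v u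
joinSym {n} G H u v with splitAt n u | splitAt n v
... | inj₁ x | inj₁ y = sym G x y
... | inj₂ x | inj₂ y = sym H x y
... | inj₁ _ | inj₂ _ = Relation.Binary.PropositionalEquality.refl
... | inj₂ _ | inj₁ _ = Relation.Binary.PropositionalEquality.refl

joinIrrefl : ∀ {n m} (G : Graph n) (H : Graph m) v → joinAdj G H v v ≡ false
joinIrrefl {n} G H v with splitAt n v
... | inj₁ x = irrefl G x
... | inj₂ x = irrefl H x

_+ᴳ_ : ∀ {n m} → Graph n → Graph m → Graph (n + m)
G +ᴳ H = record { adj = joinAdj G H ; sym = joinSym G H ; irrefl = joinIrrefl G H }

-- Colour the join by g on G and by h on H. A vertex of G keeps its neighbours in G, balanced by
-- hypothesis, and gains every vertex of H as a neighbour, so among those it sees each colour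
-- σ_H(R_i) times, a number independent of i; symmetrically for vertices of H.
module Submission where

open import Defs hiding (sym)
open import Data.Nat using (ℕ; _+_; _*_)
open import Data.Nat.Primality using (Prime)
open import Data.Bool using (Bool; true; false; _∧_)
import Data.Bool as Bool
open import Data.Fin using (Fin; zero; suc; splitAt; join; _↑ˡ_; _↑ʳ_)
open import Data.Fin.Properties using (_≟_; splitAt-↑ˡ; splitAt-↑ʳ; join-splitAt)
open import Data.List using (_∷_; _++_; filter; length; tabulate; allFin)
open import Data.List.Properties using (length-++; filter-++; filter-≐)
open import Data.Product using (∃; _,_)
open import Data.Sum using (inj₁; inj₂)
open import Data.Vec.Functional using () renaming (_++_ to _++ᶜ_)
open import Data.Vec.Functional.Properties using (lookup-++ˡ; lookup-++ʳ)
open import Function using (id; _∘_)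
open import Relation.Binary.PropositionalEquality
  using (_≡_; refl; sym; trans; cong; cong₂; subst; _≗_; module ≡-Reasoning)
open import Relation.Nullary.Decidable using (Dec; does)

private
  variable
    n m r : ℕ

IsEquitable : (Fin n → Fin r) → Set
IsEquitable f = ∀ c c′ → σ f c ≡ σ f c′

tabulate-++ : ∀ {A : Set} (f : Fin (n + m) → A) →
              tabulate f ≡ tabulate (f ∘ (_↑ˡ m)) ++ tabulate (f ∘ (n ↑ʳ_))
tabulate-++ {n = ℕ.zero}  f = refl
tabulate-++ {n = ℕ.suc n} f = cong (f zero ∷_) (tabulate-++ {n = n} (f ∘ suc))

length-filter-tabulate-∘ : ∀ {A B : Set} (p : B → Bool) (f : A → B) (g : Fin n → A) →
  length (filter (λ b → p b Bool.≟ true) (tabulate (f ∘ g))) ≡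
  length (filter (λ a → p (f a) Bool.≟ true) (tabulate g))
length-filter-tabulate-∘ {n = ℕ.zero}  p f g = refl
length-filter-tabulate-∘ {n = ℕ.suc n} p f g with p (f (g zero))
... | true  = cong ℕ.suc (length-filter-tabulate-∘ p f (g ∘ suc))
... | false = length-filter-tabulate-∘ p f (g ∘ suc)

countB-cong : {p q : Fin n → Bool} → p ≗ q → countB p ≡ countB q
countB-cong {n} p≗q =
  cong length (filter-≐ _ _ ((λ {w} → trans (sym (p≗q w))) , (λ {w} → trans (p≗q w))) (allFin n))

countB-++ : (p : Fin (n + m) → Bool) → countB p ≡ countB (p ∘ (_↑ˡ m)) + countB (p ∘ (n ↑ʳ_))
countB-++ {n} {m} p = begin
  length (filter P? (tabulate id))                          ≡⟨ cong (length ∘ filter P?) (tabulate-++ {n = n} id) ⟩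
  length (filter P? (tabulate (_↑ˡ m) ++ tabulate (n ↑ʳ_))) ≡⟨ cong length (filter-++ P? (tabulate (_↑ˡ m)) _) ⟩
  length (filter P? (tabulate (_↑ˡ m)) ++ filter P? (tabulate (n ↑ʳ_)))
    ≡⟨ length-++ (filter P? (tabulate (_↑ˡ m))) ⟩
  length (filter P? (tabulate (_↑ˡ m))) + length (filter P? (tabulate (n ↑ʳ_)))
    ≡⟨ cong₂ _+_ (length-filter-tabulate-∘ p (_↑ˡ m) id) (length-filter-tabulate-∘ p (n ↑ʳ_) id) ⟩
  countB (p ∘ (_↑ˡ m)) + countB (p ∘ (n ↑ʳ_))               ∎
  where
  open ≡-Reasoning
  P? : ∀ w → Dec (p w ≡ true)
  P? w = p w Bool.≟ true

module _ (G : Graph n) (H : Graph m) where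

  joinAdj-↑ˡ-↑ˡ : ∀ x y → joinAdj G H (x ↑ˡ m) (y ↑ˡ m) ≡ adj G x y
  joinAdj-↑ˡ-↑ˡ x y rewrite splitAt-↑ˡ n x m | splitAt-↑ˡ n y m = refl

  joinAdj-↑ˡ-↑ʳ : ∀ x y → joinAdj G H (x ↑ˡ m) (n ↑ʳ y) ≡ true
  joinAdj-↑ˡ-↑ʳ x y rewrite splitAt-↑ˡ n x m | splitAt-↑ʳ n m y = refl

  joinAdj-↑ʳ-↑ˡ : ∀ x y → joinAdj G H (n ↑ʳ x) (y ↑ˡ m) ≡ true
  joinAdj-↑ʳ-↑ˡ x y rewrite splitAt-↑ʳ n m x | splitAt-↑ˡ n y m = refl

  joinAdj-↑ʳ-↑ʳ : ∀ x y → joinAdj G H (n ↑ʳ x) (n ↑ʳ y) ≡ adj H x y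
  joinAdj-↑ʳ-↑ʳ x y rewrite splitAt-↑ʳ n m x | splitAt-↑ʳ n m y = refl

  module _ (g : Fin n → Fin r) (h : Fin m → Fin r) where

    nbrsOfColour-+ᴳ : ∀ v c → nbrsOfColour (G +ᴳ H) (g ++ᶜ h) v c ≡
      countB (λ y → joinAdj G H v (y ↑ˡ m) ∧ does (g y ≟ c)) +
      countB (λ y → joinAdj G H v (n ↑ʳ y) ∧ does (h y ≟ c))
    nbrsOfColour-+ᴳ v c = trans (countB-++ {n = n} _) (cong₂ _+_
      (countB-cong λ y → cong (λ d → joinAdj G H v (y ↑ˡ m) ∧ does (d ≟ c)) (lookup-++ˡ g h y))
      (countB-cong λ y → cong (λ d → joinAdj G H v (n ↑ʳ y) ∧ does (d ≟ c)) (lookup-++ʳ g h y)))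

    nbrsOfColour-+ᴳ-↑ˡ : ∀ x c → nbrsOfColour (G +ᴳ H) (g ++ᶜ h) (x ↑ˡ m) c ≡ nbrsOfColour G g x c + σ h c
    nbrsOfColour-+ᴳ-↑ˡ x c = trans (nbrsOfColour-+ᴳ (x ↑ˡ m) c) (cong₂ _+_
      (countB-cong λ y → cong (_∧ does (g y ≟ c)) (joinAdj-↑ˡ-↑ˡ x y))
      (countB-cong λ y → cong (_∧ does (h y ≟ c)) (joinAdj-↑ˡ-↑ʳ x y)))

    nbrsOfColour-+ᴳ-↑ʳ : ∀ x c → nbrsOfColour (G +ᴳ H) (g ++ᶜ h) (n ↑ʳ x) c ≡ σ g c + nbrsOfColour H h x c
    nbrsOfColour-+ᴳ-↑ʳ x c = trans (nbrsOfColour-+ᴳ (n ↑ʳ x) c) (cong₂ _+_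
      (countB-cong λ y → cong (_∧ does (g y ≟ c)) (joinAdj-↑ʳ-↑ˡ x y))
      (countB-cong λ y → cong (_∧ does (h y ≟ c)) (joinAdj-↑ʳ-↑ʳ x y)))

    +ᴳ-balanced-↑ˡ : IsNBColoring r G g → IsEquitable h → ∀ x c c′ →
                     nbrsOfColour (G +ᴳ H) (g ++ᶜ h) (x ↑ˡ m) c ≡ nbrsOfColour (G +ᴳ H) (g ++ᶜ h) (x ↑ˡ m) c′
    +ᴳ-balanced-↑ˡ g-nb h-eq x c c′ = begin
      nbrsOfColour (G +ᴳ H) (g ++ᶜ h) (x ↑ˡ m) c  ≡⟨ nbrsOfColour-+ᴳ-↑ˡ x c ⟩
      nbrsOfColour G g x c + σ h c                ≡⟨ cong₂ _+_ (g-nb x c c′) (h-eq c c′) ⟩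
      nbrsOfColour G g x c′ + σ h c′              ≡⟨ nbrsOfColour-+ᴳ-↑ˡ x c′ ⟨
      nbrsOfColour (G +ᴳ H) (g ++ᶜ h) (x ↑ˡ m) c′ ∎
      where open ≡-Reasoning

    +ᴳ-balanced-↑ʳ : IsEquitable g → IsNBColoring r H h → ∀ x c c′ →
                     nbrsOfColour (G +ᴳ H) (g ++ᶜ h) (n ↑ʳ x) c ≡ nbrsOfColour (G +ᴳ H) (g ++ᶜ h) (n ↑ʳ x) c′
    +ᴳ-balanced-↑ʳ g-eq h-nb x c c′ = begin
      nbrsOfColour (G +ᴳ H) (g ++ᶜ h) (n ↑ʳ x) c  ≡⟨ nbrsOfColour-+ᴳ-↑ʳ x c ⟩
      σ g c + nbrsOfColour H h x c                ≡⟨ cong₂ _+_ (g-eq c c′) (h-nb x c c′) ⟩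
      σ g c′ + nbrsOfColour H h x c′              ≡⟨ nbrsOfColour-+ᴳ-↑ʳ x c′ ⟨
      nbrsOfColour (G +ᴳ H) (g ++ᶜ h) (n ↑ʳ x) c′ ∎
      where open ≡-Reasoning

    +ᴳ-isNBColoring : IsNBColoring r G g → IsEquitable g → IsNBColoring r H h → IsEquitable h →
                      IsNBColoring r (G +ᴳ H) (g ++ᶜ h)
    +ᴳ-isNBColoring g-nb g-eq h-nb h-eq v c c′ =
      subst Balanced (join-splitAt n m v) (balanced-join (splitAt n v))
      where
      Balanced : Fin (n + m) → Set
      Balanced u = nbrsOfColour (G +ᴳ H) (g ++ᶜ h) u c ≡ nbrsOfColour (G +ᴳ H) (g ++ᶜ h) u c′
      balanced-join : ∀ s → Balanced (join n m s)
      balanced-join (inj₁ x) = +ᴳ-balanced-↑ˡ g-nb h-eq x c c′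
      balanced-join (inj₂ x) = +ᴳ-balanced-↑ʳ g-eq h-nb x c c′

theorem2p13 : (k : ℕ) → 1 Data.Nat.≤ k → Prime (2 * k + 1) →
    {n m : ℕ} (G : Graph n) (H : Graph m) →
    (g : Fin n → Fin (2 * k + 1)) → IsNBColoring (2 * k + 1) G g →
    (∀ c c′ → σ g c ≡ σ g c′) →
    (h : Fin m → Fin (2 * k + 1)) → IsNBColoring (2 * k + 1) H h →
    (∀ c c′ → σ h c ≡ σ h c′) →
    ∃ λ (f : Fin (n + m) → Fin (2 * k + 1)) → IsNBColoring (2 * k + 1) (G +ᴳ H) f
theorem2p13 _ _ _ G H g g-nb g-eq h h-nb h-eq =
  g ++ᶜ h , +ᴳ-isNBColoring G H g h g-nb g-eq h-nb h-eq
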